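{- Let $v$ be a simplicial vertex of degree at least one in a graph $G$, and let $w$ be a neighbor of $v$. Then $\mathcal{A}(G)>\mathcal{A}(G-vw)$.
   Context: All graphs are finite, simple and undirected. A coloring of a graph $G$ assigns colors to its vertices so that adjacent vertices receive different colors; two colorings are equivalent if they induce the same partition of the vertex set into color classes. $S(G,k)$ denotes the number of non-equivalent colorings of $G$ using exactly $k$ colors. Set $\mathcal{B}(G)=\sum_{k\ge1}S(G,k)$, $\mathcal{T}(G)=\sum_{k\ge1}kS(G,k)$ and $\mathcal{A}(G)=\mathcal{T}(G)/\mathcal{B}(G)$. A vertex is simplicial if its neighbors induce a clique. $G-vw$ denotes the graph obtained from $G$ by removing the edge $vw$. -}

module Defs where

open import Data.Bool using (Bool; true; false; _∧_; _∨_; not)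
open import Data.Bool.Properties using (∧-comm; ∨-comm)
open import Data.Nat using (ℕ; zero; suc; _+_; _*_)
open import Data.Fin using (Fin; zero; suc; _≟_)
open import Data.List using (List; []; _∷_; map; concatMap; filter; length; allFin; deduplicateᵇ; applyUpTo)
open import Data.Bool.ListAction using (all; any)
open import Data.Nat.ListAction using (sum)
open import Data.Vec.Functional using () renaming (_∷_ to _∷ᶠ_)
open import Data.Integer using (+_)
open import Data.Rational using (ℚ; _/_; 0ℚ)
open import Relation.Nullary using (does)
open import Relation.Unary using (Decidable)
open import Data.Bool using (T?)
open import Relation.Binary.PropositionalEquality using (_≡_; cong₂; trans)

_==_ : ∀ {n} → Fin n → Fin n → Bool
i == j = does (i ≟ j)

_⇔ᵇ_ : Bool → Bool → Bool
true  ⇔ᵇ b = b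
false ⇔ᵇ b = not b

record Graph (n : ℕ) : Set where
  field
    adj    : Fin n → Fin n → Bool
    adj-sym    : ∀ i j → adj i j ≡ adj j i
    adj-irrefl : ∀ i → adj i i ≡ false
open Graph public

removeEdge : ∀ {n} → Graph n → Fin n → Fin n → Graph n
removeEdge {n} G v w = record { adj = a ; adj-sym = s ; adj-irrefl = r }
  where
  isVW : Fin n → Fin n → Bool
  isVW i j = ((i == v) ∧ (j == w)) ∨ ((i == w) ∧ (j == v))
  isVW-sym : ∀ i j → isVW i j ≡ isVW j i
  isVW-sym i j =
    trans (∨-comm ((i == v) ∧ (j == w)) ((i == w) ∧ (j == v)))
          (cong₂ _∨_ (∧-comm (i == w) (j == v)) (∧-comm (i == v) (j == w)))
  a : Fin n → Fin n → Bool
  a i j = adj G i j ∧ not (isVW i j)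
  s : ∀ i j → a i j ≡ a j i
  s i j = cong₂ (λ x y → x ∧ not y) (adj-sym G i j) (isVW-sym i j)
  r : ∀ i → a i i ≡ false
  r i = cong₂ (λ x y → x ∧ not y) (adj-irrefl G i) (isVW-sym i i) 

Simplicial : ∀ {n} → Graph n → Fin n → Set
Simplicial G v = ∀ x y → adj G v x ≡ true → adj G v y ≡ true →
                 ¬ (x ≡ y) → adj G x y ≡ true
  where open import Relation.Nullary using (¬_)

allMaps : (n k : ℕ) → List (Fin n → Fin k)
allMaps zero    k = (λ ()) ∷ []
allMaps (suc n) k = concatMap (λ f → map (λ c → c ∷ᶠ f) (allFin k)) (allMaps n k)

isProper : ∀ {n k} → Graph n → (Fin n → Fin k) → Bool
isProper {n} G c = all (λ i → all (λ j → not (adj G i j ∧ (c i == c j))) (allFin n)) (allFin n)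

isOnto : ∀ {n k} → (Fin n → Fin k) → Bool
isOnto {n} {k} c = all (λ x → any (λ i → c i == x) (allFin n)) (allFin k)

equivColoring : ∀ {n k} → (Fin n → Fin k) → (Fin n → Fin k) → Bool
equivColoring {n} c d =
  all (λ i → all (λ j → (c i == c j) ⇔ᵇ (d i == d j)) (allFin n)) (allFin n)

colorings : ∀ {n} → Graph n → (k : ℕ) → List (Fin n → Fin k)
colorings {n} G k = filter (λ c → T? (isProper G c ∧ isOnto c)) (allMaps n k)

-- S(G,k): number of non-equivalent colorings using exactly k colors
-- (one representative kept per equivalence class)
S : ∀ {n} → Graph n → ℕ → ℕ
S G k = length (deduplicateᵇ equivColoring (colorings G k))

-- S(G,k) = 0 for k > n, so the sums over k ≥ 1 are the sums over 1 ≤ k ≤ n.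
𝓑 : ∀ {n} → Graph n → ℕ
𝓑 {n} G = sum (applyUpTo (λ i → S G (suc i)) n)

𝓣 : ∀ {n} → Graph n → ℕ
𝓣 {n} G = sum (applyUpTo (λ i → suc i * S G (suc i)) n)

-- A(G) = T(G) / B(G) as a rational (B(G) ≥ 1 whenever n ≥ 1;
-- the value 0 for B(G) = 0 is never used in the statement).
𝓐 : ∀ {n} → Graph n → ℚ
𝓐 G with 𝓑 G
... | zero  = 0ℚ
... | suc b = (+ 𝓣 G) / suc b

-- Let G′ = G - vw and let a k be the number of partitions of the vertices induced by k-colourings
-- of G′ in which v and w share a colour. Splitting the colourings of G′ according to whether v and
-- w share a colour gives S(G′,k) = a k + S(G,k). Moving v into the class of w turns a colouring of
-- G with k+1 colours into a merged colouring of G′: with k colours if v was alone in its class, and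
-- otherwise with k+1 colours, v having come from one of its classes that avoid the neighbourhood
-- N(v). As N(v) is a clique of G′, its d = deg v vertices lie in d different classes, so
-- S(G,k+1) = a k + a (k+1) · (k+1 ∸ d). Hence, with b i = a (i+1) and g i = (i+1 ∸ d) + 1,
-- B(G) = Σ b i g i, T(G) = Σ b i ((i+1) g i + 1), B(G′) = B(G) + Σ b i and T(G′) = T(G) + Σ (i+1) b i,
-- and A(G′) < A(G) amounts to (Σ (i+1) b i)(Σ b i g i) < (Σ b i ((i+1) g i + 1))(Σ b i). This is
-- Chebyshev's sum inequality for the increasing sequences i+1 and g i, plus the term (Σ b i)² > 0.

module Submission where

open import Defs
open import Level using (Level; 0ℓ; _⊔_)
open import Data.Bool using (Bool; true; false; T; T?; not; _∧_)
open import Data.Bool.Properties using (T-≡; T-∧)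
open import Data.Bool.ListAction using (all; any)
open import Data.Empty using (⊥-elim)
open import Data.Fin using (Fin; zero; suc; _≟_; punchIn; punchOut)
open import Data.Fin.Properties
  using (¬Fin0; 0≢1+n; any?; suc-injective; injective⇒≤; punchOut-cong; punchOut-injective; punchOut-punchIn;
         punchIn-punchOut; punchInᵢ≢i)
open import Data.Integer as ℤ using (+<+)
open import Data.Integer.Properties using (pos-*)
open import Data.List using (List; []; _∷_; _++_; map; concatMap; filter; allFin; applyUpTo; deduplicate; length)
open import Data.List.Properties using (length-++; length-map; length-tabulate; length-removeAt′)
open import Data.List.Membership.Propositional using (_∈_; find; lose)
open import Data.List.Membership.Propositional.Properties
  using (∈-allFin; ∈-deduplicate⁻; ∈-filter⁺; ∈-filter⁻; ∈-map⁺; ∈-map⁻; ∈-concatMap⁺)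
open import Data.List.Relation.Binary.Disjoint.Setoid using (Disjoint)
open import Data.List.Relation.Unary.All as All using (All; []; _∷_)
open import Data.List.Relation.Unary.AllPairs as AllPairs using (AllPairs; []; _∷_)
open import Data.List.Relation.Unary.Any as Any using (Any; here; there; _─_)
open import Data.List.Relation.Unary.Any.Properties using (any⁺; any⁻)
open import Data.Nat using (ℕ; zero; suc; _+_; _*_; _∸_; _≤_; _<_; z≤n; s≤s)
open import Data.Nat.ListAction using (sum)
open import Data.Nat.Properties
  using (≤-antisym; ≤-trans; ≤-reflexive; ≤-total; ≮⇒≥; <⇒≱; <-irrefl; n<1+n; m≤m+n; m≤n+m; m<m+n;
         +-assoc; +-comm; +-identityʳ; +-suc; +-mono-≤; +-mono-<; +-monoˡ-<; m+[n∸m]≡n; m+n∸m≡n; ∸-monoˡ-≤;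
         *-comm; *-zeroʳ; *-suc; *-distribˡ-+; *-distribʳ-+; *-monoʳ-≤; *-mono-<;
         +-commutativeSemigroup; module ≤-Reasoning)
open import Algebra.Properties.CommutativeSemigroup +-commutativeSemigroup using (interchange)
open import Data.Nat.Tactic.RingSolver using (solve-∀)
open import Data.Product using (∃; _×_; _,_; proj₁; proj₂)
open import Data.Rational using (_/_; _>_)
open import Data.Rational.Properties using (toℚᵘ-cancel-<; toℚᵘ-fromℚᵘ)
open import Data.Rational.Unnormalised using (mkℚᵘ; *<*)
open import Data.Rational.Unnormalised.Properties using (<-respˡ-≃; <-respʳ-≃; ≃-sym)
open import Data.Sum using (_⊎_; inj₁; inj₂)
open import Data.Unit using (tt)
open import Data.Vec.Functional using () renaming (_∷_ to _∷ᶠ_)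
open import Function using (_∘_; id; flip; _⇔_; mk⇔; Equivalence)
open import Function.Definitions using (StrictlySurjective)
open import Relation.Binary.Bundles using (Setoid; DecSetoid)
open import Relation.Binary.Definitions using (_Respects_; Monotonic₁)
open import Relation.Binary.PropositionalEquality as ≡
  using (_≡_; _≢_; refl; sym; trans; cong; cong₂; subst; subst₂; _≗_; module ≡-Reasoning)
open import Relation.Nullary using (¬_; ¬?; Dec; yes; no; does; contradiction)
open import Relation.Nullary.Decidable using (_×-dec_; dec-true; dec-false)
open import Relation.Unary using (Pred; Decidable; _∩_; ∁; _≐_)
open import Relation.Unary.Properties using (∁?)
import Data.Bool as Bool
import Data.Rational as ℚ
import Data.List.Membership.Setoid as SetoidMembership
import Data.List.Membership.Setoid.Properties as SetoidMembershipₚ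
import Data.List.Relation.Unary.All.Properties as Allₚ
import Data.List.Relation.Unary.AllPairs.Properties as AllPairsₚ
import Data.List.Relation.Unary.Unique.DecSetoid.Properties as UniqueDecSetoidₚ
import Data.List.Relation.Unary.Unique.Propositional.Properties as Uniqueₚ
import Data.List.Relation.Unary.Unique.Setoid as UniqueSetoid
import Data.List.Relation.Unary.Unique.Setoid.Properties as UniqueSetoidₚ

private
  variable
    c ℓ p : Level
    n k : ℕ

-- Transversals of a setoid

module _ (𝒮 : Setoid c ℓ) where

  open Setoid 𝒮 using (_≈_) renaming (Carrier to A; sym to ≈-sym; trans to ≈-trans)
  open SetoidMembership 𝒮 using () renaming (_∈_ to _∈ₛ_)
  open UniqueSetoid 𝒮 using (Unique)

  record IsTransversal (P : Pred A p) (ys : List A) : Set (c ⊔ ℓ ⊔ p) where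
    field
      unique   : Unique ys
      sound    : All P ys
      complete : ∀ {x} → P x → x ∈ₛ ys

  ∈-─⁺ : ∀ {x y zs} (y∈zs : y ∈ₛ zs) → x ∈ₛ zs → ¬ x ≈ y → x ∈ₛ (zs ─ y∈zs)
  ∈-─⁺ (here y≈z) (here x≈z) x≉y = ⊥-elim (x≉y (≈-trans x≈z (≈-sym y≈z)))
  ∈-─⁺ (here _)   (there x∈) _   = x∈
  ∈-─⁺ (there _)  (here x≈z) _   = here x≈z
  ∈-─⁺ (there y∈) (there x∈) x≉y = there (∈-─⁺ y∈ x∈ x≉y)

  unique-⊆⇒length≤ : ∀ {ys zs} → Unique ys → All (_∈ₛ zs) ys → length ys ≤ length zs
  unique-⊆⇒length≤ []                 []             = z≤n
  unique-⊆⇒length≤ {zs = zs} (y≉ys ∷ ys!) (y∈zs ∷ ys⊆zs) =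
    ≤-trans (s≤s (unique-⊆⇒length≤ ys! ys⊆zs─y)) (≤-reflexive (sym (length-removeAt′ zs _)))
    where
    ys⊆zs─y = All.zipWith (λ (x≉y , x∈) → ∈-─⁺ y∈zs x∈ (x≉y ∘ ≈-sym)) (y≉ys , ys⊆zs)

  transversal-length : ∀ {P : Pred A p} {ys zs} →
    IsTransversal P ys → IsTransversal P zs → length ys ≡ length zs
  transversal-length tys tzs = ≤-antisym (bound tys tzs) (bound tzs tys)
    where
    open IsTransversal
    bound : ∀ {P : Pred A p} {ys zs} → IsTransversal P ys → IsTransversal P zs → length ys ≤ length zs
    bound tys tzs = unique-⊆⇒length≤ (unique tys) (All.map (complete tzs) (sound tys))

  transversal-resp-≐ : ∀ {P Q : Pred A p} {ys} → P ≐ Q → IsTransversal P ys → IsTransversal Q ys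
  transversal-resp-≐ (P⊆Q , Q⊆P) t = record
    { unique = unique ; sound = All.map P⊆Q sound ; complete = complete ∘ Q⊆P }
    where open IsTransversal t

  transversal-++ : ∀ {P : Pred A p} {Q : Pred A p} → Q Respects _≈_ → Decidable Q → ∀ {ys zs} →
    IsTransversal (P ∩ Q) ys → IsTransversal (P ∩ ∁ Q) zs → IsTransversal P (ys ++ zs)
  transversal-++ {P = P} {Q} resp Q? {ys} {zs} tys tzs = record
    { unique   = UniqueSetoidₚ.++⁺ 𝒮 (unique tys) (unique tzs) disjoint
    ; sound    = Allₚ.++⁺ (All.map proj₁ (sound tys)) (All.map proj₁ (sound tzs))
    ; complete = complete′
    }
    where
    open IsTransversal
    disjoint : ∀ {x} → ¬ (x ∈ₛ ys × x ∈ₛ zs)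
    disjoint (x∈ys , x∈zs) =
      All.lookupₛ 𝒮 ∁-resp (All.map proj₂ (sound tzs)) x∈zs (All.lookupₛ 𝒮 resp (All.map proj₂ (sound tys)) x∈ys)
      where
      ∁-resp : ∁ Q Respects _≈_
      ∁-resp x≈y ¬Qx Qy = ¬Qx (resp (≈-sym x≈y) Qy)
    complete′ : ∀ {x} → P x → x ∈ₛ ys ++ zs
    complete′ {x} Px with Q? x
    ... | yes Qx = SetoidMembershipₚ.∈-++⁺ˡ 𝒮 (complete tys (Px , Qx))
    ... | no ¬Qx = SetoidMembershipₚ.∈-++⁺ʳ 𝒮 ys (complete tzs (Px , ¬Qx))

  transversal-nonempty : ∀ {P : Pred A p} {x ys} → IsTransversal P ys → P x → 0 < length ys
  transversal-nonempty t Px = SetoidMembershipₚ.∈-length 𝒮 (IsTransversal.complete t Px)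

module _ (D : DecSetoid c ℓ) where

  open DecSetoid D using (setoid) renaming (_≟_ to _≈?_; refl to ≈-refl; sym to ≈-sym; trans to ≈-trans)
  open SetoidMembership setoid using () renaming (_∈_ to _∈ₛ_)

  deduplicate-isTransversal : ∀ xs → IsTransversal setoid (_∈ₛ xs) (deduplicate _≈?_ xs)
  deduplicate-isTransversal xs = record
    { unique   = UniqueDecSetoidₚ.deduplicate-! D xs
    ; sound    = All.tabulate λ y∈ → Any.map (λ { refl → ≈-refl }) (∈-deduplicate⁻ _≈?_ xs y∈)
    ; complete = SetoidMembershipₚ.∈-deduplicate⁺ setoid _≈?_ (λ y≈z x≈y → ≈-trans x≈y (≈-sym y≈z))
    }

module _ {a b p r r′} {A : Set a} {B : Set b} {P : A → Set p} {R : A → A → Set r} {R′ : B → B → Set r′} where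

  allPairs-map⁺-on : ∀ {f : A → B} → (∀ {x y} → P x → P y → R x y → R′ (f x) (f y)) →
    ∀ {xs} → All P xs → AllPairs R xs → AllPairs R′ (map f xs)
  allPairs-map⁺-on f-resp []         []             = []
  allPairs-map⁺-on f-resp (px ∷ pxs) (Rxxs ∷ Rxs!) =
    Allₚ.map⁺ (All.zipWith (λ (Rxy , py) → f-resp px py Rxy) (Rxxs , pxs)) ∷ allPairs-map⁺-on f-resp pxs Rxs!

module _ {a} {A : Set a} where

  length-concatMap-const : ∀ {b} {B : Set b} {f : A → List B} {m xs} →
    All (λ x → length (f x) ≡ m) xs → length (concatMap f xs) ≡ length xs * m
  length-concatMap-const []                            = refl
  length-concatMap-const {f = f} {xs = x ∷ _} (fx≡m ∷ fxs≡m) =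
    trans (length-++ (f x)) (cong₂ _+_ fx≡m (length-concatMap-const fxs≡m))

  length-filter+length-filter-∁ : ∀ {p} {P : Pred A p} (P? : Decidable P) xs →
    length (filter P? xs) + length (filter (∁? P?) xs) ≡ length xs
  length-filter+length-filter-∁ P? []       = refl
  length-filter+length-filter-∁ P? (x ∷ xs) with does (P? x)
  ... | true  = cong suc (length-filter+length-filter-∁ P? xs)
  ... | false = trans (+-suc _ _) (cong suc (length-filter+length-filter-∁ P? xs))

-- Sums, Chebyshev's inequality and the averaging step

-- 𝓑 G and 𝓣 G unfold to ∑ n (λ i → S G (suc i)) and ∑ n (λ i → suc i * S G (suc i)).
∑ : ℕ → (ℕ → ℕ) → ℕ
∑ n f = sum (applyUpTo f n)

∑-cong : ∀ n {f g : ℕ → ℕ} → (∀ i → f i ≡ g i) → ∑ n f ≡ ∑ n g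
∑-cong zero    f≗g = refl
∑-cong (suc n) f≗g = cong₂ _+_ (f≗g 0) (∑-cong n (f≗g ∘ suc))

∑-mono-≤ : ∀ n {f g : ℕ → ℕ} → (∀ i → f i ≤ g i) → ∑ n f ≤ ∑ n g
∑-mono-≤ zero    f≤g = z≤n
∑-mono-≤ (suc n) f≤g = +-mono-≤ (f≤g 0) (∑-mono-≤ n (f≤g ∘ suc))

∑-distrib-+ : ∀ n (f g : ℕ → ℕ) → ∑ n (λ i → f i + g i) ≡ ∑ n f + ∑ n g
∑-distrib-+ zero    f g = refl
∑-distrib-+ (suc n) f g =
  trans (cong (f 0 + g 0 +_) (∑-distrib-+ n (f ∘ suc) (g ∘ suc))) (interchange (f 0) (g 0) _ _)

∑-distribˡ-* : ∀ n c (f : ℕ → ℕ) → ∑ n (λ i → c * f i) ≡ c * ∑ n f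
∑-distribˡ-* zero    c f = sym (*-zeroʳ c)
∑-distribˡ-* (suc n) c f =
  trans (cong (c * f 0 +_) (∑-distribˡ-* n c (f ∘ suc))) (sym (*-distribˡ-+ c (f 0) _))

∑-distribʳ-* : ∀ n c (f : ℕ → ℕ) → ∑ n (λ i → f i * c) ≡ ∑ n f * c
∑-distribʳ-* n c f = trans (∑-cong n (λ i → *-comm (f i) c)) (trans (∑-distribˡ-* n c f) (*-comm c _))

∑-comm : ∀ m n (F : ℕ → ℕ → ℕ) → ∑ m (λ i → ∑ n (F i)) ≡ ∑ n (λ j → ∑ m (λ i → F i j))
∑-comm zero    n F = sym (∑-zero n)
  where
  ∑-zero : ∀ n → ∑ n (λ _ → 0) ≡ 0
  ∑-zero zero    = refl
  ∑-zero (suc n) = ∑-zero n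
∑-comm (suc m) n F =
  trans (cong (∑ n (F 0) +_) (∑-comm m n (F ∘ suc))) (sym (∑-distrib-+ n (F 0) _))

∑*∑ : ∀ m n (f g : ℕ → ℕ) → ∑ m f * ∑ n g ≡ ∑ m (λ i → ∑ n (λ j → f i * g j))
∑*∑ m n f g = trans (sym (∑-distribʳ-* m (∑ n g) f)) (∑-cong m (λ i → sym (∑-distribˡ-* n (f i) g)))

∑-snoc : ∀ n f → ∑ (suc n) f ≡ ∑ n f + f n
∑-snoc zero    f = +-comm (f 0) 0
∑-snoc (suc n) f = trans (cong (f 0 +_) (∑-snoc n (f ∘ suc))) (sym (+-assoc (f 0) _ _))

∑-shift : ∀ n (f : ℕ → ℕ) → f 0 ≡ 0 → f n ≡ 0 → ∑ n f ≡ ∑ n (f ∘ suc)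
∑-shift zero    f _    _    = refl
∑-shift (suc n) f f0≡0 fn≡0 = begin
  f 0 + ∑ n (f ∘ suc)     ≡⟨ cong (_+ ∑ n (f ∘ suc)) f0≡0 ⟩
  ∑ n (f ∘ suc)           ≡⟨ +-identityʳ _ ⟨
  ∑ n (f ∘ suc) + 0       ≡⟨ cong (∑ n (f ∘ suc) +_) fn≡0 ⟨
  ∑ n (f ∘ suc) + f (suc n) ≡⟨ ∑-snoc n (f ∘ suc) ⟨
  ∑ (suc n) (f ∘ suc)     ∎
  where open ≡-Reasoning

term≤∑ : ∀ n f {i} → i < n → f i ≤ ∑ n f
term≤∑ (suc n) f {zero}  _         = m≤m+n (f 0) _
term≤∑ (suc n) f {suc i} (s≤s i<n) = ≤-trans (term≤∑ n (f ∘ suc) i<n) (m≤n+m _ (f 0))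

rearrangement : ∀ {x y p q} → x ≤ y → p ≤ q → x * q + y * p ≤ x * p + y * q
rearrangement {x} {y} {p} {q} x≤y p≤q =
  subst₂ (λ y q → x * q + y * p ≤ x * p + y * q) (m+[n∸m]≡n x≤y) (m+[n∸m]≡n p≤q)
         (subst (x * (p + t) + (x + s) * p ≤_) (gap x s p t) (m≤m+n _ (s * t)))
  where
  s = y ∸ x
  t = q ∸ p
  gap : ∀ x s p t → x * (p + t) + (x + s) * p + s * t ≡ x * p + (x + s) * (p + t)
  gap = solve-∀

∑² : ℕ → (ℕ → ℕ → ℕ) → ℕ
∑² n F = ∑ n (λ i → ∑ n (F i))

∑²-symmetrize : ∀ n F → ∑² n F + ∑² n F ≡ ∑² n (λ i j → F i j + F j i)
∑²-symmetrize n F = begin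
  ∑² n F + ∑² n F                          ≡⟨ cong (∑² n F +_) (∑-comm n n F) ⟩
  ∑² n F + ∑² n (λ i j → F j i)            ≡⟨ ∑-distrib-+ n (λ i → ∑ n (F i)) _ ⟨
  ∑ n (λ i → ∑ n (F i) + ∑ n (λ j → F j i)) ≡⟨ ∑-cong n (λ i → ∑-distrib-+ n (F i) _) ⟨
  ∑² n (λ i j → F i j + F j i)             ∎
  where open ≡-Reasoning

module _ {f g : ℕ → ℕ} (f-mono : Monotonic₁ _≤_ _≤_ f) (g-mono : Monotonic₁ _≤_ _≤_ g) where

  similarlyOrdered : ∀ i j → f i * g j + f j * g i ≤ f i * g i + f j * g j
  similarlyOrdered i j with ≤-total i j
  ... | inj₁ i≤j = rearrangement (f-mono i≤j) (g-mono i≤j)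
  ... | inj₂ j≤i = subst₂ _≤_ (+-comm (f j * g i) _) (+-comm (f j * g j) _)
                            (rearrangement (f-mono j≤i) (g-mono j≤i))

  chebyshev : ∀ n (w : ℕ → ℕ) →
    ∑ n (λ i → w i * f i) * ∑ n (λ i → w i * g i) ≤ ∑ n w * ∑ n (λ i → w i * (f i * g i))
  chebyshev n w = ≮⇒≥ (λ R<L → <⇒≱ (+-mono-< R<L R<L) L+L≤R+R)
    where
    L = ∑ n (λ i → w i * f i) * ∑ n (λ i → w i * g i)
    R = ∑ n w * ∑ n (λ i → w i * (f i * g i))
    P Q : ℕ → ℕ → ℕ
    P i j = w i * f i * (w j * g j)
    Q i j = w i * (w j * (f j * g j))
    P-sym : ∀ i j → P i j + P j i ≡ w i * w j * (f i * g j + f j * g i)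
    P-sym i j = lemma (w i) (w j) (f i) (f j) (g i) (g j)
      where
      lemma : ∀ wi wj fi fj gi gj → wi * fi * (wj * gj) + wj * fj * (wi * gi) ≡ wi * wj * (fi * gj + fj * gi)
      lemma = solve-∀
    Q-sym : ∀ i j → Q i j + Q j i ≡ w i * w j * (f i * g i + f j * g j)
    Q-sym i j = lemma (w i) (w j) (f i) (f j) (g i) (g j)
      where
      lemma : ∀ wi wj fi fj gi gj → wi * (wj * (fj * gj)) + wj * (wi * (fi * gi)) ≡ wi * wj * (fi * gi + fj * gj)
      lemma = solve-∀
    pointwise : ∀ i j → P i j + P j i ≤ Q i j + Q j i
    pointwise i j = begin
      P i j + P j i                         ≡⟨ P-sym i j ⟩
      w i * w j * (f i * g j + f j * g i)   ≤⟨ *-monoʳ-≤ (w i * w j) (similarlyOrdered i j) ⟩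
      w i * w j * (f i * g i + f j * g j)   ≡⟨ Q-sym i j ⟨
      Q i j + Q j i                         ∎
      where open ≤-Reasoning
    L+L≤R+R : L + L ≤ R + R
    L+L≤R+R = begin
      L + L                               ≡⟨ cong₂ _+_ (∑*∑ n n _ _) (∑*∑ n n _ _) ⟩
      ∑² n P + ∑² n P                     ≡⟨ ∑²-symmetrize n P ⟩
      ∑² n (λ i j → P i j + P j i)        ≤⟨ ∑-mono-≤ n (λ i → ∑-mono-≤ n (pointwise i)) ⟩
      ∑² n (λ i j → Q i j + Q j i)        ≡⟨ ∑²-symmetrize n Q ⟨
      ∑² n Q + ∑² n Q                     ≡⟨ cong₂ _+_ (∑*∑ n n _ _) (∑*∑ n n _ _) ⟨
      R + R                               ∎
      where open ≤-Reasoning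

mediant-< : ∀ {t₁ b₁ t b} → t₁ * b < t * b₁ → (t₁ + t) * b < t * (b₁ + b)
mediant-< {t₁} {b₁} {t} {b} t₁b<tb₁ = begin-strict
  (t₁ + t) * b    ≡⟨ *-distribʳ-+ b t₁ t ⟩
  t₁ * b + t * b  <⟨ +-monoˡ-< (t * b) t₁b<tb₁ ⟩
  t * b₁ + t * b  ≡⟨ *-distribˡ-+ t b₁ b ⟨
  t * (b₁ + b)    ∎
  where open ≤-Reasoning

-- In the application s i = S(G, i+1), s′ i = S(G - vw, i+1), d = deg v and a k is the number of
-- partitions induced by k-colourings of G - vw in which v and w share a colour.
module _ (n d : ℕ) (a s : ℕ → ℕ) (a0≡0 : a 0 ≡ 0) (an≡0 : a n ≡ 0)
         (s≡ : ∀ i → s i ≡ a i + a (suc i) * (suc i ∸ d)) where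

  private
    b r g : ℕ → ℕ
    b = a ∘ suc
    r i = suc i ∸ d
    g i = suc (r i)

  𝓑-formula : ∑ n s ≡ ∑ n (λ i → b i * g i)
  𝓑-formula = begin
    ∑ n s                              ≡⟨ ∑-cong n s≡ ⟩
    ∑ n (λ i → a i + b i * r i)        ≡⟨ ∑-distrib-+ n a _ ⟩
    ∑ n a + ∑ n (λ i → b i * r i)      ≡⟨ cong (_+ ∑ n (λ i → b i * r i)) (∑-shift n a a0≡0 an≡0) ⟩
    ∑ n b + ∑ n (λ i → b i * r i)      ≡⟨ ∑-distrib-+ n b _ ⟨
    ∑ n (λ i → b i + b i * r i)        ≡⟨ ∑-cong n (λ i → *-suc (b i) (r i)) ⟨
    ∑ n (λ i → b i * g i)              ∎
    where open ≡-Reasoning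

  𝓣-formula : ∑ n (λ i → suc i * s i) ≡ ∑ n (λ i → b i * (suc i * g i)) + ∑ n b
  𝓣-formula = begin
    ∑ n (λ i → suc i * s i)                                      ≡⟨ ∑-cong n expand ⟩
    ∑ n (λ i → suc i * a i + suc i * (b i * r i))                ≡⟨ ∑-distrib-+ n _ _ ⟩
    ∑ n (λ i → suc i * a i) + ∑ n (λ i → suc i * (b i * r i))    ≡⟨ cong (_+ ∑ n (λ i → suc i * (b i * r i))) shifted ⟩
    ∑ n (λ i → (2 + i) * b i) + ∑ n (λ i → suc i * (b i * r i))    ≡⟨ ∑-distrib-+ n _ _ ⟨
    ∑ n (λ i → (2 + i) * b i + suc i * (b i * r i))                ≡⟨ ∑-cong n (λ i → regroup (b i) i (r i)) ⟩
    ∑ n (λ i → b i * (suc i * g i) + b i)                        ≡⟨ ∑-distrib-+ n _ b ⟩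
    ∑ n (λ i → b i * (suc i * g i)) + ∑ n b                      ∎
    where
    open ≡-Reasoning
    expand : ∀ i → suc i * s i ≡ suc i * a i + suc i * (b i * r i)
    expand i = trans (cong (suc i *_) (s≡ i)) (*-distribˡ-+ (suc i) (a i) _)
    shifted : ∑ n (λ i → suc i * a i) ≡ ∑ n (λ i → (2 + i) * b i)
    shifted = ∑-shift n (λ i → suc i * a i) (trans (cong (1 *_) a0≡0) (*-zeroʳ 1))
                                           (trans (cong (suc n *_) an≡0) (*-zeroʳ (suc n)))
    regroup : ∀ x i r → (2 + i) * x + suc i * (x * r) ≡ x * (suc i * suc r) + x
    regroup = solve-∀

  mergedMean-< : 0 < ∑ n b → ∑ n (λ i → suc i * b i) * ∑ n s < ∑ n (λ i → suc i * s i) * ∑ n b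
  mergedMean-< 0<∑b = begin-strict
    ∑ n (λ i → suc i * b i) * ∑ n s                    ≡⟨ cong₂ _*_ (∑-cong n (λ i → *-comm (suc i) (b i))) 𝓑-formula ⟩
    ∑ n (λ i → b i * suc i) * ∑ n (λ i → b i * g i)    ≤⟨ chebyshev s≤s (λ i≤j → s≤s (∸-monoˡ-≤ d (s≤s i≤j))) n b ⟩
    ∑ n b * X                                          ≡⟨ *-comm (∑ n b) X ⟩
    X * ∑ n b                                          <⟨ m<m+n _ (*-mono-< 0<∑b 0<∑b) ⟩
    X * ∑ n b + ∑ n b * ∑ n b                          ≡⟨ *-distribʳ-+ (∑ n b) X (∑ n b) ⟨
    (X + ∑ n b) * ∑ n b                                ≡⟨ cong (_* ∑ n b) 𝓣-formula ⟨
    ∑ n (λ i → suc i * s i) * ∑ n b                    ∎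
    where
    open ≤-Reasoning
    X = ∑ n (λ i → b i * (suc i * g i))

  averageInequality : ∀ (s′ : ℕ → ℕ) → (∀ i → s′ i ≡ a (suc i) + s i) → 0 < ∑ n a →
    ∑ n (λ i → suc i * s′ i) * ∑ n s < ∑ n (λ i → suc i * s i) * ∑ n s′
  averageInequality s′ s′≡ 0<∑a =
    subst₂ _<_ (cong (_* ∑ n s) (sym 𝓣′-formula)) (cong (t *_) (sym 𝓑′-formula))
      (mediant-< {∑ n (λ i → suc i * b i)} {∑ n b} {t} {∑ n s} (mergedMean-< 0<∑b))
    where
    t = ∑ n (λ i → suc i * s i)
    0<∑b : 0 < ∑ n b
    0<∑b = subst (0 <_) (∑-shift n a a0≡0 an≡0) 0<∑a
    𝓑′-formula : ∑ n s′ ≡ ∑ n b + ∑ n s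
    𝓑′-formula = trans (∑-cong n s′≡) (∑-distrib-+ n b s)
    𝓣′-formula : ∑ n (λ i → suc i * s′ i) ≡ ∑ n (λ i → suc i * b i) + t
    𝓣′-formula = trans (∑-cong n (λ i → trans (cong (suc i *_) (s′≡ i)) (*-distribˡ-+ (suc i) (b i) (s i))))
                       (∑-distrib-+ n _ _)

-- Reflecting the boolean definitions

T-== : ∀ {i j : Fin n} → T (i == j) ⇔ i ≡ j
T-== {i = i} {j} with i ≟ j
... | yes i≡j = mk⇔ (λ _ → i≡j) (λ _ → tt)
... | no  i≢j = mk⇔ (λ ()) i≢j

==-cong : ∀ {i j : Fin n} {i′ j′ : Fin k} →
  (i ≡ j → i′ ≡ j′) → (i′ ≡ j′ → i ≡ j) → (i == j) ≡ (i′ == j′)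
==-cong {i = i} {j} {i′} {j′} to from with i ≟ j | i′ ≟ j′
... | yes _   | yes _     = refl
... | no  _   | no  _     = refl
... | yes i≡j | no i′≢j′  = contradiction (to i≡j) i′≢j′
... | no i≢j  | yes i′≡j′ = contradiction (from i′≡j′) i≢j

==-sym : ∀ (i j : Fin n) → (i == j) ≡ (j == i)
==-sym i j = ==-cong {i = i} {j} {j} {i} sym sym

==∧==≡false : ∀ {i i′ j j′ : Fin n} → ¬ (i ≡ i′ × j ≡ j′) → ((i == i′) ∧ (j == j′)) ≡ false
==∧==≡false {i = i} {i′} {j} {j′} ¬eq with i ≟ i′
... | no  _    = refl
... | yes i≡i′ = dec-false (j ≟ j′) (λ j≡j′ → ¬eq (i≡i′ , j≡j′))

T-all-allFin : ∀ {p : Fin n → Bool} → T (all p (allFin n)) ⇔ (∀ i → T (p i))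
T-all-allFin {n} {p} = mk⇔
  (λ h i → All.lookup (Allₚ.all⁺ p (allFin n) h) (∈-allFin i))
  (λ h → Allₚ.all⁻ p {allFin n} (All.tabulate (λ {i} _ → h i)))

T-any-allFin : ∀ {p : Fin n → Bool} → T (any p (allFin n)) ⇔ ∃ λ i → T (p i)
T-any-allFin {n} {p} = mk⇔
  (Any.satisfied ∘ any⁻ p (allFin n))
  (λ (i , pi) → any⁺ {xs = allFin n} p (lose (∈-allFin i) pi))

T-not-∧-== : ∀ a {x y : Fin k} → T (not (a ∧ (x == y))) ⇔ (a ≡ true → x ≢ y)
T-not-∧-== false = mk⇔ (λ _ ()) (λ _ → tt)
T-not-∧-== true {x} {y} with x ≟ y
... | yes x≡y = mk⇔ (λ ()) (λ x≢y → x≢y refl x≡y)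
... | no  x≢y = mk⇔ (λ _ _ → x≢y) (λ _ → tt)

T-⇔ᵇ : ∀ {a b} → T (a ⇔ᵇ b) ⇔ a ≡ b
T-⇔ᵇ {true}  {true}  = mk⇔ (λ _ → refl) (λ _ → tt)
T-⇔ᵇ {true}  {false} = mk⇔ (λ ()) (λ ())
T-⇔ᵇ {false} {true}  = mk⇔ (λ ()) (λ ())
T-⇔ᵇ {false} {false} = mk⇔ (λ _ → refl) (λ _ → tt)

-- Colourings and the partitions they induce

Proper : Graph n → (Fin n → Fin k) → Set
Proper G c = ∀ {i j} → adj G i j ≡ true → c i ≢ c j

IsColoring : Graph n → (Fin n → Fin k) → Set
IsColoring G c = Proper G c × StrictlySurjective _≡_ c

-- A record rather than a function type, so that c and d can be inferred from c ≋ d.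
record _≋_ (c d : Fin n → Fin k) : Set where
  constructor mk≋
  field classes : ∀ i j → (c i == c j) ≡ (d i == d j)
open _≋_ public

≋-refl : ∀ {c : Fin n → Fin k} → c ≋ c
≋-refl = mk≋ λ _ _ → refl

≋-sym : ∀ {c d : Fin n → Fin k} → c ≋ d → d ≋ c
≋-sym c≋d = mk≋ λ i j → sym (classes c≋d i j)

≋-trans : ∀ {c d e : Fin n → Fin k} → c ≋ d → d ≋ e → c ≋ e
≋-trans c≋d d≋e = mk≋ λ i j → trans (classes c≋d i j) (classes d≋e i j)

≗⇒≋ : ∀ {c d : Fin n → Fin k} → c ≗ d → c ≋ d
≗⇒≋ c≗d = mk≋ λ i j → cong₂ _==_ (c≗d i) (c≗d j)

≋-transport : ∀ {c d : Fin n → Fin k} → c ≋ d → ∀ {i j} → c i ≡ c j → d i ≡ d j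
≋-transport c≋d {i} {j} = Equivalence.to T-== ∘ subst T (classes c≋d i j) ∘ Equivalence.from T-==

≋-off : ∀ {c d : Fin n → Fin k} (v : Fin n) →
  (∀ {i j} → i ≢ v → j ≢ v → (c i == c j) ≡ (d i == d j)) →
  (∀ {j} → j ≢ v → (c v == c j) ≡ (d v == d j)) → c ≋ d
≋-off {c = c} {d} v off at-v = mk≋ classes′
  where
  classes′ : ∀ i j → (c i == c j) ≡ (d i == d j)
  classes′ i j with i ≟ v | j ≟ v
  ... | yes refl | yes refl = trans (dec-true (c v ≟ c v) refl) (sym (dec-true (d v ≟ d v) refl))
  ... | yes refl | no j≢v   = at-v j≢v
  ... | no i≢v   | yes refl = trans (==-sym (c i) (c v)) (trans (at-v i≢v) (==-sym (d v) (d i)))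
  ... | no i≢v   | no j≢v   = off i≢v j≢v

≋-off-merged : ∀ {c d : Fin n → Fin k} {v w : Fin n} → w ≢ v → c v ≡ c w → d v ≡ d w →
  (∀ {i j} → i ≢ v → j ≢ v → (c i == c j) ≡ (d i == d j)) → c ≋ d
≋-off-merged {c = c} {d} {v} {w} w≢v cv≡cw dv≡dw off = ≋-off v off λ {j} j≢v →
  trans (cong (_== c j) cv≡cw) (trans (off w≢v j≢v) (cong (_== d j) (sym dv≡dw)))

T-isProper : ∀ {G : Graph n} {c : Fin n → Fin k} → T (isProper G c) ⇔ Proper G c
T-isProper {G = G} {c} = mk⇔
  (λ h {i} {j} → to (T-not-∧-== (adj G i j)) (to T-all-allFin (to T-all-allFin h i) j))
  (λ h → from T-all-allFin λ i → from T-all-allFin λ j → from (T-not-∧-== (adj G i j)) h)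
  where open Equivalence

T-isOnto : ∀ {c : Fin n → Fin k} → T (isOnto c) ⇔ StrictlySurjective _≡_ c
T-isOnto = mk⇔
  (λ h x → let i , ci==x = to T-any-allFin (to T-all-allFin h x) in i , to T-== ci==x)
  (λ h → from T-all-allFin λ x → from T-any-allFin (proj₁ (h x) , from T-== (proj₂ (h x))))
  where open Equivalence

T-equivColoring : ∀ {c d : Fin n → Fin k} → T (equivColoring c d) ⇔ c ≋ d
T-equivColoring = mk⇔
  (λ h → mk≋ λ i j → to T-⇔ᵇ (to T-all-allFin (to T-all-allFin h i) j))
  (λ h → from T-all-allFin λ i → from T-all-allFin λ j → from T-⇔ᵇ (classes h i j))
  where open Equivalence

≈⇒≋ : ∀ {c d : Fin n → Fin k} → T (equivColoring c d) → c ≋ d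
≈⇒≋ = Equivalence.to T-equivColoring

≋⇒≈ : ∀ {c d : Fin n → Fin k} → c ≋ d → T (equivColoring c d)
≋⇒≈ = Equivalence.from T-equivColoring

-- _≟_ is chosen so that deduplicate _≟_ is literally the deduplicateᵇ equivColoring in the definition of S.
partitionDecSetoid : ℕ → ℕ → DecSetoid 0ℓ 0ℓ
partitionDecSetoid n k = record
  { Carrier          = Fin n → Fin k
  ; _≈_              = λ c d → T (equivColoring c d)
  ; isDecEquivalence = record
    { isEquivalence = record
      { refl  = λ {c} → ≋⇒≈ {c = c} ≋-refl
      ; sym   = λ {c} {d} c≈d → ≋⇒≈ (≋-sym (≈⇒≋ {c = c} {d} c≈d))
      ; trans = λ {c} {d} {e} c≈d d≈e → ≋⇒≈ (≋-trans (≈⇒≋ {c = c} {d} c≈d) (≈⇒≋ {c = d} {e} d≈e))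
      }
    ; _≟_ = λ c d → T? (equivColoring c d)
    }
  }

partitionSetoid : ℕ → ℕ → Setoid 0ℓ 0ℓ
partitionSetoid n k = DecSetoid.setoid (partitionDecSetoid n k)

_∈≋_ : (Fin n → Fin k) → List (Fin n → Fin k) → Set
_∈≋_ {n} {k} = SetoidMembership._∈_ (partitionSetoid n k)

S≡length : ∀ {G : Graph n} {ys} → IsTransversal (partitionSetoid n k) (_∈≋ colorings G k) ys → S G k ≡ length ys
S≡length {n} {k} {G} =
  transversal-length (partitionSetoid n k) (deduplicate-isTransversal (partitionDecSetoid n k) (colorings G k))

allMaps-complete : ∀ n k (c : Fin n → Fin k) → ∃ λ d → d ∈ allMaps n k × d ≗ c
allMaps-complete zero    k c = _ , here refl , λ ()
allMaps-complete (suc n) k c with allMaps-complete n k (c ∘ suc)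
... | d , d∈ , d≗c = (c zero ∷ᶠ d) , ∈-concatMap⁺ extend (lose d∈ (∈-map⁺ (_∷ᶠ d) (∈-allFin (c zero))))
                   , λ { zero → refl ; (suc i) → d≗c i }
  where
  extend : (Fin n → Fin k) → List (Fin (suc n) → Fin k)
  extend f = map (_∷ᶠ f) (allFin k)

∈-colorings⁻ : ∀ (G : Graph n) {c : Fin n → Fin k} → c ∈ colorings G k → IsColoring G c
∈-colorings⁻ {n} {k} G {c} c∈ =
  let proper , onto = to (T-∧ {isProper G c})
                         (proj₂ (∈-filter⁻ (λ c → T? (isProper G c ∧ isOnto c)) {xs = allMaps n k} c∈))
  in to (T-isProper {G = G} {c}) proper , to (T-isOnto {c = c}) onto
  where open Equivalence

-- Without function extensionality only a pointwise copy of c is known to occur in colorings G k.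
∈≋-colorings⁺ : ∀ (G : Graph n) {c : Fin n → Fin k} → IsColoring G c → c ∈≋ colorings G k
∈≋-colorings⁺ {n} {k} G {c} (proper , onto) with allMaps-complete n k c
... | d , d∈ , d≗c = lose d∈colorings (≋⇒≈ {c = c} {d} (≗⇒≋ (sym ∘ d≗c)))
  where
  open Equivalence
  d∈colorings : d ∈ colorings G k
  d∈colorings = ∈-filter⁺ (λ c → T? (isProper G c ∧ isOnto c)) d∈ (from (T-∧ {isProper G d})
    ( from (T-isProper {G = G} {d}) (λ {i} {j} ij∈G → proper ij∈G ∘ trans (sym (d≗c i)) ∘ flip trans (d≗c j))
    , from (T-isOnto {c = d}) (λ x → let i , ci≡x = onto x in i , trans (d≗c i) ci≡x)))

∈≋-colorings-transfer : ∀ (H H′ : Graph n) {c : Fin n → Fin k} →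
  (∀ {d} → c ≋ d → IsColoring H d → IsColoring H′ d) → c ∈≋ colorings H k → c ∈≋ colorings H′ k
∈≋-colorings-transfer {n} {k} H H′ {c} transfer c∈ with find c∈
... | d , d∈ , c≈d = SetoidMembershipₚ.∈-resp-≈ (partitionSetoid n k) {x = d} {c}
                       (DecSetoid.sym (partitionDecSetoid n k) {c} {d} c≈d)
                       (∈≋-colorings⁺ H′ (transfer (≈⇒≋ c≈d) (∈-colorings⁻ H d∈)))

edge⇒≢ : ∀ (G : Graph n) {i j} → adj G i j ≡ true → i ≢ j
edge⇒≢ G {i} ij∈G refl = contradiction (trans (sym ij∈G) (adj-irrefl G i)) λ ()

id-isColoring : ∀ (G : Graph n) → IsColoring G id
id-isColoring G = edge⇒≢ G , λ x → x , refl

S-positive : ∀ (G : Graph n) → 0 < S G n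
S-positive {n} G = transversal-nonempty (partitionSetoid n n) {x = id}
  (deduplicate-isTransversal (partitionDecSetoid n n) (colorings G n)) (∈≋-colorings⁺ G (id-isColoring G))

surjective⇒≤ : ∀ {m n} {f : Fin m → Fin n} → StrictlySurjective _≡_ f → n ≤ m
surjective⇒≤ {f = f} surj = injective⇒≤ {f = proj₁ ∘ surj} λ {x} {y} eq →
  trans (sym (proj₂ (surj x))) (trans (cong f eq) (proj₂ (surj y)))

-- Deleting the vertex v keeps f surjective, because its colour is also carried by w.
merging-surjective⇒< : ∀ {f : Fin n → Fin k} {v w} → v ≢ w → f v ≡ f w → StrictlySurjective _≡_ f → k < n
merging-surjective⇒< {zero} {v = ()}
merging-surjective⇒< {suc n} {f = f} {v} {w} v≢w fv≡fw surj = s≤s (surjective⇒≤ {f = f ∘ punchIn v} surj′)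
  where
  surj′ : StrictlySurjective _≡_ (f ∘ punchIn v)
  surj′ x with surj x
  ... | u , fu≡x with v ≟ u
  ...   | no v≢u   = _ , trans (cong f (punchIn-punchOut v≢u)) fu≡x
  ...   | yes refl = _ , trans (cong f (punchIn-punchOut v≢w)) (trans (sym fv≡fw) fu≡x)

-- Removing an edge at a simplicial vertex

module SimplicialEdgeRemoval {n} (G : Graph n) {v w : Fin n}
                             (simplicial : Simplicial G v) (vw∈G : adj G v w ≡ true) where

  G′ : Graph n
  G′ = removeEdge G v w

  v≢w : v ≢ w
  v≢w = edge⇒≢ G vw∈G

  G′⊆G : ∀ {i j} → adj G′ i j ≡ true → adj G i j ≡ true
  G′⊆G {i} {j} ij∈G′ = to T-≡ (proj₁ (to (T-∧ {adj G i j}) (from T-≡ ij∈G′)))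
    where open Equivalence

  G⊆G′ : ∀ {i j} → adj G i j ≡ true → ¬ (i ≡ v × j ≡ w) → ¬ (i ≡ w × j ≡ v) → adj G′ i j ≡ true
  G⊆G′ ij∈G ¬vw ¬wv rewrite ij∈G | ==∧==≡false ¬vw | ==∧==≡false ¬wv = refl

  G⊆G′-off-v : ∀ {i j} → adj G i j ≡ true → i ≢ v → j ≢ v → adj G′ i j ≡ true
  G⊆G′-off-v ij∈G i≢v j≢v = G⊆G′ ij∈G (i≢v ∘ proj₁) (j≢v ∘ proj₂)

  vw∉G′ : adj G′ v w ≡ false
  vw∉G′ rewrite vw∈G | dec-true (v ≟ v) refl | dec-true (w ≟ w) refl = refl

  proper-G⇒G′ : ∀ {k} {c : Fin n → Fin k} → Proper G c → Proper G′ c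
  proper-G⇒G′ proper ij∈G′ = proper (G′⊆G ij∈G′)

  proper-G′⇒G : ∀ {k} {c : Fin n → Fin k} → Proper G′ c → c v ≢ c w → Proper G c
  proper-G′⇒G proper cv≢cw {i} {j} ij∈G with (i ≟ v) ×-dec (j ≟ w) | (i ≟ w) ×-dec (j ≟ v)
  ... | yes (refl , refl) | _                 = cv≢cw
  ... | no _              | yes (refl , refl) = cv≢cw ∘ sym
  ... | no ¬vw            | no ¬wv            = proper (G⊆G′ ij∈G ¬vw ¬wv)

  redirect : Fin n → Fin n
  redirect u with u ≟ v
  ... | yes _ = w
  ... | no  _ = u

  redirect-v : redirect v ≡ w
  redirect-v with v ≟ v
  ... | yes _   = refl
  ... | no  v≢v = contradiction refl v≢v

  redirect-≢ : ∀ {u} → u ≢ v → redirect u ≡ u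
  redirect-≢ {u} u≢v with u ≟ v
  ... | yes u≡v = contradiction u≡v u≢v
  ... | no  _   = refl

  redirect≢v : ∀ u → redirect u ≢ v
  redirect≢v u with u ≟ v
  ... | yes _   = v≢w ∘ sym
  ... | no  u≢v = u≢v

  -- Since the neighbourhood of v is a clique, moving v onto w turns edges of G - vw into edges of G.
  redirect-edge : ∀ {i j} → adj G′ i j ≡ true → adj G (redirect i) (redirect j) ≡ true
  redirect-edge {i} {j} ij∈G′ = edge (G′⊆G ij∈G′)
    (λ { refl refl → false≢true (trans (sym vw∉G′) ij∈G′) })
    (λ { refl refl → false≢true (trans (sym vw∉G′) (trans (adj-sym G′ v w) ij∈G′)) })
    where
    false≢true : false ≢ true
    false≢true ()
    edge : ∀ {i j} → adj G i j ≡ true → (i ≡ v → j ≢ w) → (j ≡ v → i ≢ w) →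
           adj G (redirect i) (redirect j) ≡ true
    edge {i} {j} ij∈G vi⇒j≢w vj⇒i≢w with i ≟ v | j ≟ v
    ... | yes refl | yes refl = ⊥-elim (edge⇒≢ G ij∈G refl)
    ... | yes refl | no  j≢v =
          simplicial w j vw∈G ij∈G (λ w≡j → vi⇒j≢w refl (sym w≡j))
    ... | no  i≢v  | yes refl =
          simplicial i w (trans (adj-sym G v i) ij∈G) vw∈G (vj⇒i≢w refl)
    ... | no  i≢v  | no  j≢v = ij∈G

  Merged : ∀ {k} → (Fin n → Fin k) → Set
  Merged c = T (c v == c w)

  merged? : ∀ {k} → Decidable (Merged {k})
  merged? c = T? (c v == c w)

  Merged-resp : ∀ {k} {c d : Fin n → Fin k} → T (equivColoring c d) → Merged c → Merged d
  Merged-resp {c = c} {d} c≈d = subst T (classes (≈⇒≋ {c = c} {d} c≈d) v w)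

  IsMergedColoring : ∀ {k} → (Fin n → Fin k) → Set
  IsMergedColoring e = IsColoring G′ e × e v ≡ e w

  merged : ∀ k → List (Fin n → Fin k)
  merged k = filter merged? (colorings G′ k)

  mergedClasses : ∀ k → List (Fin n → Fin k)
  mergedClasses k = deduplicate (DecSetoid._≟_ (partitionDecSetoid n k)) (merged k)

  mergedCount : ℕ → ℕ
  mergedCount k = length (mergedClasses k)

  ∈-mergedClasses⁻ : ∀ {k} {e : Fin n → Fin k} → e ∈ mergedClasses k → IsMergedColoring e
  ∈-mergedClasses⁻ {k} e∈ =
    let e∈colorings , ev==ew = ∈-filter⁻ merged? {xs = colorings G′ k} (∈-deduplicate⁻ _ (merged k) e∈)
    in ∈-colorings⁻ G′ e∈colorings , Equivalence.to T-== ev==ew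

  mergedClasses-complete : ∀ {k} {e : Fin n → Fin k} → IsMergedColoring e →
    ∃ λ e′ → e′ ∈ mergedClasses k × e ≋ e′
  mergedClasses-complete {k} {e} (coloring , ev≡ew) =
    let e′ , e′∈ , e≈e′ = find (IsTransversal.complete transversal {e} e∈≋merged) in e′ , e′∈ , ≈⇒≋ e≈e′
    where
    transversal = deduplicate-isTransversal (partitionDecSetoid n k) (merged k)
    e∈≋merged : e ∈≋ merged k
    e∈≋merged = SetoidMembershipₚ.∈-filter⁺ (partitionSetoid n k) merged? (λ {c} {d} → Merged-resp {c = c} {d})
                  {v = e} (∈≋-colorings⁺ G′ coloring) (Equivalence.from T-== ev≡ew)

  S-removeEdge : ∀ k → S G′ k ≡ mergedCount k + S G k
  S-removeEdge k = trans (S≡length {G = G′} split) (length-++ (mergedClasses k))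
    where
    setoid = partitionSetoid n k
    mergedPart : (_∈≋ merged k) ≐ ((_∈≋ colorings G′ k) ∩ Merged)
    mergedPart = (λ {c} → SetoidMembershipₚ.∈-filter⁻ setoid merged? (λ {c} {d} → Merged-resp {c = c} {d}) {c})
               , (λ {c} (c∈ , merged-c) →
                    SetoidMembershipₚ.∈-filter⁺ setoid merged? (λ {c} {d} → Merged-resp {c = c} {d}) {c} c∈ merged-c)
    ¬Merged : ∀ {c} → c ∈≋ colorings G k → ¬ Merged c
    ¬Merged {c} c∈ merged-c with find c∈
    ... | d , d∈ , c≈d =
      proj₁ (∈-colorings⁻ G d∈) vw∈G (≋-transport (≈⇒≋ {c = c} {d} c≈d) (Equivalence.to T-== merged-c))
    unmergedPart : (_∈≋ colorings G k) ≐ ((_∈≋ colorings G′ k) ∩ ∁ Merged)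
    unmergedPart =
        (λ {c} c∈ → ∈≋-colorings-transfer G G′ {c} (λ _ (proper , onto) → proper-G⇒G′ proper , onto) c∈
                  , ¬Merged {c} c∈)
      , (λ { {c} (c∈ , ¬merged-c) → ∈≋-colorings-transfer G′ G {c}
               (λ c≋d (proper , onto) →
                  proper-G′⇒G proper (¬merged-c ∘ Equivalence.from T-== ∘ ≋-transport (≋-sym c≋d)) , onto)
               c∈ })
    split : IsTransversal setoid (_∈≋ colorings G′ k)
              (mergedClasses k ++ deduplicate (DecSetoid._≟_ (partitionDecSetoid n k)) (colorings G k))
    split = transversal-++ setoid {Q = Merged} (λ {c} {d} → Merged-resp {c = c} {d}) merged?
              (transversal-resp-≐ setoid mergedPart (deduplicate-isTransversal (partitionDecSetoid n k) (merged k)))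
              (transversal-resp-≐ setoid unmergedPart (deduplicate-isTransversal (partitionDecSetoid n k) (colorings G k)))

  Shared : ∀ {k} → (Fin n → Fin k) → Set
  Shared c = ∃ λ u → u ≢ v × c u ≡ c v

  shared? : ∀ {k} (c : Fin n → Fin k) → Dec (Shared c)
  shared? c = any? λ u → ¬? (u ≟ v) ×-dec (c u ≟ c v)

  Shared-resp : ∀ {k} {c d : Fin n → Fin k} → T (equivColoring c d) → Shared c → Shared d
  Shared-resp {c = c} {d} c≈d (u , u≢v , cu≡cv) = u , u≢v , ≋-transport (≈⇒≋ {c = c} {d} c≈d) cu≡cv

  merged-onto-off-v : ∀ {k} {e : Fin n → Fin k} → IsMergedColoring e → ∀ x → ∃ λ u → u ≢ v × e u ≡ x
  merged-onto-off-v {e = e} ((_ , onto) , ev≡ew) x with onto x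
  ... | u , eu≡x with u ≟ v
  ...   | yes refl = w , v≢w ∘ sym , trans (sym ev≡ew) eu≡x
  ...   | no  u≢v  = u , u≢v , eu≡x

  isolate : ∀ {k} → (Fin n → Fin k) → Fin n → Fin (suc k)
  isolate e u with u ≟ v
  ... | yes _ = zero
  ... | no  _ = suc (e u)

  isolate-v : ∀ {k} (e : Fin n → Fin k) → isolate e v ≡ zero
  isolate-v e with v ≟ v
  ... | yes _   = refl
  ... | no  v≢v = contradiction refl v≢v

  isolate-≢ : ∀ {k} (e : Fin n → Fin k) {u} → u ≢ v → isolate e u ≡ suc (e u)
  isolate-≢ e {u} u≢v with u ≟ v
  ... | yes u≡v = contradiction u≡v u≢v
  ... | no  _   = refl

  isolate-view : ∀ {k} (e : Fin n → Fin k) u →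
    (u ≡ v × isolate e u ≡ zero) ⊎ (u ≢ v × isolate e u ≡ suc (e u))
  isolate-view e u with u ≟ v
  ... | yes u≡v = inj₁ (u≡v , refl)
  ... | no  u≢v = inj₂ (u≢v , refl)

  isolate-off-v : ∀ {k} (e : Fin n → Fin k) {i j} → i ≢ v → j ≢ v → (isolate e i == isolate e j) ≡ (e i == e j)
  isolate-off-v e i≢v j≢v rewrite isolate-≢ e i≢v | isolate-≢ e j≢v = refl

  isolate-at-v : ∀ {k} (e : Fin n → Fin k) {j} → j ≢ v → (isolate e v == isolate e j) ≡ false
  isolate-at-v e j≢v rewrite isolate-v e | isolate-≢ e j≢v = refl

  isolate-isColoring : ∀ {k} {e : Fin n → Fin k} → IsMergedColoring e → IsColoring G (isolate e)
  isolate-isColoring {e = e} merged-e@((proper , _) , _) = proper′ , onto′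
    where
    proper′ : Proper G (isolate e)
    proper′ {i} {j} ij∈G with isolate-view e i | isolate-view e j
    ... | inj₁ (refl , _)     | inj₁ (refl , _)     = ⊥-elim (edge⇒≢ G ij∈G refl)
    ... | inj₁ (_ , ei≡0)     | inj₂ (_ , ej≡suc)   = λ eq → 0≢1+n (trans (sym ei≡0) (trans eq ej≡suc))
    ... | inj₂ (_ , ei≡suc)   | inj₁ (_ , ej≡0)     = λ eq → 0≢1+n (trans (sym ej≡0) (trans (sym eq) ei≡suc))
    ... | inj₂ (i≢v , ei≡suc) | inj₂ (j≢v , ej≡suc) =
          λ eq → proper (G⊆G′-off-v ij∈G i≢v j≢v) (suc-injective (trans (sym ei≡suc) (trans eq ej≡suc)))
    onto′ : StrictlySurjective _≡_ (isolate e)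
    onto′ zero    = v , isolate-v e
    onto′ (suc x) = let u , u≢v , eu≡x = merged-onto-off-v merged-e x in u , trans (isolate-≢ e u≢v) (cong suc eu≡x)

  isolate-¬Shared : ∀ {k} (e : Fin n → Fin k) → ¬ Shared (isolate e)
  isolate-¬Shared e (u , u≢v , eq) = contradiction (trans (sym (isolate-≢ e u≢v)) (trans eq (isolate-v e))) λ ()

  isolate-cong : ∀ {k} {e e′ : Fin n → Fin k} → e ≋ e′ → isolate e ≋ isolate e′
  isolate-cong {e = e} {e′} e≋e′ = ≋-off v
    (λ {i} {j} i≢v j≢v →
       trans (isolate-off-v e i≢v j≢v) (trans (classes e≋e′ i j) (sym (isolate-off-v e′ i≢v j≢v))))
    (λ j≢v → trans (isolate-at-v e j≢v) (sym (isolate-at-v e′ j≢v)))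

  isolate-injective : ∀ {k} {e e′ : Fin n → Fin k} → IsMergedColoring e → IsMergedColoring e′ →
    isolate e ≋ isolate e′ → e ≋ e′
  isolate-injective {e = e} {e′} (_ , ev≡ew) (_ , e′v≡e′w) ie≋ie′ =
    ≋-off-merged (v≢w ∘ sym) ev≡ew e′v≡e′w λ {i} {j} i≢v j≢v →
      trans (sym (isolate-off-v e i≢v j≢v)) (trans (classes ie≋ie′ i j) (isolate-off-v e′ i≢v j≢v))

  module _ {k} {c : Fin n → Fin (suc k)} (coloring : IsColoring G c) (¬shared : ¬ Shared c) where

    cv≢c∘redirect : ∀ u → c v ≢ c (redirect u)
    cv≢c∘redirect u eq = ¬shared (redirect u , redirect≢v u , sym eq)

    deleteV : Fin n → Fin k
    deleteV u = punchOut (cv≢c∘redirect u)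

    deleteV-cong : ∀ {i j} → c (redirect i) ≡ c (redirect j) → deleteV i ≡ deleteV j
    deleteV-cong {i} {j} = punchOut-cong (c v) {i≢j = cv≢c∘redirect i} {i≢k = cv≢c∘redirect j}

    deleteV-injective : ∀ {i j} → deleteV i ≡ deleteV j → c (redirect i) ≡ c (redirect j)
    deleteV-injective {i} {j} = punchOut-injective (cv≢c∘redirect i) (cv≢c∘redirect j)

    deleteV-merged : IsMergedColoring deleteV
    deleteV-merged =
      (proper′ , onto′) , deleteV-cong {v} {w} (cong c (trans redirect-v (sym (redirect-≢ (v≢w ∘ sym)))))
      where
      proper′ : Proper G′ deleteV
      proper′ {i} {j} ij∈G′ eq = proj₁ coloring (redirect-edge ij∈G′) (deleteV-injective {i} {j} eq)
      onto′ : StrictlySurjective _≡_ deleteV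
      onto′ x with proj₂ coloring (punchIn (c v) x)
      ... | u , cu≡x′ =
        u , trans (punchOut-cong (c v) (trans (cong c (redirect-≢ u≢v)) cu≡x′)) (punchOut-punchIn (c v))
        where
        u≢v : u ≢ v
        u≢v refl = punchInᵢ≢i (c v) x (sym cu≡x′)

    isolate-deleteV : c ≋ isolate deleteV
    isolate-deleteV = ≋-off v
      (λ {i} {j} i≢v j≢v →
         trans (==-cong (deleteV-cong {i} {j} ∘ redirected i≢v j≢v)
                        (unredirected i≢v j≢v ∘ deleteV-injective {i} {j}))
               (sym (isolate-off-v deleteV i≢v j≢v)))
      (λ {j} j≢v →
         trans (dec-false (c v ≟ c j) (λ cv≡cj → ¬shared (j , j≢v , sym cv≡cj))) (sym (isolate-at-v deleteV j≢v)))
      where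
      redirected : ∀ {i j} → i ≢ v → j ≢ v → c i ≡ c j → c (redirect i) ≡ c (redirect j)
      redirected i≢v j≢v ci≡cj = trans (cong c (redirect-≢ i≢v)) (trans ci≡cj (cong c (sym (redirect-≢ j≢v))))
      unredirected : ∀ {i j} → i ≢ v → j ≢ v → c (redirect i) ≡ c (redirect j) → c i ≡ c j
      unredirected i≢v j≢v eq = trans (cong c (sym (redirect-≢ i≢v))) (trans eq (cong c (redirect-≢ j≢v)))

  isolated-transversal : ∀ k → IsTransversal (partitionSetoid n (suc k))
    ((_∈≋ colorings G (suc k)) ∩ ∁ Shared) (map isolate (mergedClasses k))
  isolated-transversal k = record
    { unique   = allPairs-map⁺-on distinct (All.tabulate ∈-mergedClasses⁻)
                   (IsTransversal.unique (deduplicate-isTransversal (partitionDecSetoid n k) (merged k)))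
    ; sound    = Allₚ.map⁺ (All.tabulate λ {e} e∈ →
                   ∈≋-colorings⁺ G (isolate-isColoring (∈-mergedClasses⁻ e∈)) , isolate-¬Shared e)
    ; complete = complete′
    }
    where
    open Equivalence
    distinct : ∀ {e e′ : Fin n → Fin k} → IsMergedColoring e → IsMergedColoring e′ →
      ¬ T (equivColoring e e′) → ¬ T (equivColoring (isolate e) (isolate e′))
    distinct {e} {e′} me me′ e≉e′ ie≈ie′ =
      e≉e′ (≋⇒≈ (isolate-injective me me′ (≈⇒≋ {c = isolate e} {isolate e′} ie≈ie′)))
    through : ∀ {c d} → d ∈ colorings G (suc k) → c ≋ d → ¬ Shared d → c ∈≋ map isolate (mergedClasses k)
    through {c} d∈ c≋d ¬shared-d =
      let e , e∈ , d₀≋e = mergedClasses-complete (deleteV-merged (∈-colorings⁻ G d∈) ¬shared-d)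
      in lose (∈-map⁺ isolate e∈) (≋⇒≈ {c = c} {isolate e}
           (≋-trans c≋d (≋-trans (isolate-deleteV (∈-colorings⁻ G d∈) ¬shared-d) (isolate-cong d₀≋e))))
    complete′ : ∀ {c} → c ∈≋ colorings G (suc k) × ¬ Shared c → c ∈≋ map isolate (mergedClasses k)
    complete′ {c} (c∈ , ¬shared-c) with find c∈
    ... | d , d∈ , c≈d = through d∈ c≋d (¬shared-c ∘ Shared-resp {c = d} {c} (≋⇒≈ {c = d} {c} (≋-sym c≋d)))
      where
      c≋d : c ≋ d
      c≋d = ≈⇒≋ c≈d

  Used : ∀ {k} → (Fin n → Fin k) → Fin k → Set
  Used e x = ∃ λ u → adj G v u ≡ true × e u ≡ x

  used? : ∀ {k} (e : Fin n → Fin k) → Decidable (Used e)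
  used? e x = any? λ u → (adj G v u Bool.≟ true) ×-dec (e u ≟ x)

  usedColours freeColours : ∀ {k} → (Fin n → Fin k) → List (Fin k)
  usedColours {k} e = filter (used? e) (allFin k)
  freeColours {k} e = filter (∁? (used? e)) (allFin k)

  recolor : ∀ {k} → (Fin n → Fin k) → Fin k → Fin n → Fin k
  recolor e x u with u ≟ v
  ... | yes _ = x
  ... | no  _ = e u

  recolor-view : ∀ {k} (e : Fin n → Fin k) x u → (u ≡ v × recolor e x u ≡ x) ⊎ (u ≢ v × recolor e x u ≡ e u)
  recolor-view e x u with u ≟ v
  ... | yes u≡v = inj₁ (u≡v , refl)
  ... | no  u≢v = inj₂ (u≢v , refl)

  recolor-v : ∀ {k} (e : Fin n → Fin k) x → recolor e x v ≡ x
  recolor-v e x with v ≟ v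
  ... | yes _   = refl
  ... | no  v≢v = contradiction refl v≢v

  recolor-≢ : ∀ {k} (e : Fin n → Fin k) x {u} → u ≢ v → recolor e x u ≡ e u
  recolor-≢ e x {u} u≢v with u ≟ v
  ... | yes u≡v = contradiction u≡v u≢v
  ... | no  _   = refl

  recolor-off-v : ∀ {k} (e : Fin n → Fin k) x {i j} → i ≢ v → j ≢ v →
    (recolor e x i == recolor e x j) ≡ (e i == e j)
  recolor-off-v e x i≢v j≢v rewrite recolor-≢ e x i≢v | recolor-≢ e x j≢v = refl

  recolor-isColoring : ∀ {k} {e : Fin n → Fin k} {x} → IsMergedColoring e → ¬ Used e x → IsColoring G (recolor e x)
  recolor-isColoring {e = e} {x} merged-e@((proper , _) , _) x-free = proper′ , onto′
    where
    proper′ : Proper G (recolor e x)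
    proper′ {i} {j} ij∈G with recolor-view e x i | recolor-view e x j
    ... | inj₁ (refl , _)    | inj₁ (refl , _)    = ⊥-elim (edge⇒≢ G ij∈G refl)
    ... | inj₁ (refl , ri≡x) | inj₂ (_ , rj≡ej)   =
          λ eq → x-free (j , ij∈G , sym (trans (sym ri≡x) (trans eq rj≡ej)))
    ... | inj₂ (_ , ri≡ei)   | inj₁ (refl , rj≡x) =
          λ eq → x-free (i , trans (adj-sym G v i) ij∈G , trans (sym ri≡ei) (trans eq rj≡x))
    ... | inj₂ (i≢v , ri≡ei) | inj₂ (j≢v , rj≡ej) =
          λ eq → proper (G⊆G′-off-v ij∈G i≢v j≢v) (trans (sym ri≡ei) (trans eq rj≡ej))
    onto′ : StrictlySurjective _≡_ (recolor e x)
    onto′ y = let u , u≢v , eu≡y = merged-onto-off-v merged-e y in u , trans (recolor-≢ e x u≢v) eu≡y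

  recolor-Shared : ∀ {k} {e : Fin n → Fin k} {x} → IsMergedColoring e → Shared (recolor e x)
  recolor-Shared {e = e} {x} merged-e =
    let u , u≢v , eu≡x = merged-onto-off-v merged-e x
    in u , u≢v , trans (recolor-≢ e x u≢v) (trans eu≡x (sym (recolor-v e x)))

  recolor-injective : ∀ {k} {e : Fin n → Fin k} {x x′} → IsMergedColoring e →
    recolor e x ≋ recolor e x′ → x ≡ x′
  recolor-injective {e = e} {x} {x′} merged-e r≋r′ =
    let u , u≢v , eu≡x = merged-onto-off-v merged-e x
        same : recolor e x u ≡ recolor e x v
        same = trans (recolor-≢ e x u≢v) (trans eu≡x (sym (recolor-v e x)))
    in trans (sym eu≡x) (trans (sym (recolor-≢ e x′ u≢v))
                               (trans (≋-transport r≋r′ {u} {v} same) (recolor-v e x′)))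

  recolor-reflects-≋ : ∀ {k} {e e′ : Fin n → Fin k} {x x′} → IsMergedColoring e → IsMergedColoring e′ →
    recolor e x ≋ recolor e′ x′ → e ≋ e′
  recolor-reflects-≋ {e = e} {e′} {x} {x′} (_ , ev≡ew) (_ , e′v≡e′w) r≋r′ =
    ≋-off-merged (v≢w ∘ sym) ev≡ew e′v≡e′w λ {i} {j} i≢v j≢v →
      trans (sym (recolor-off-v e x i≢v j≢v)) (trans (classes r≋r′ i j) (recolor-off-v e′ x′ i≢v j≢v))

  redirect-merged : ∀ {k} {d : Fin n → Fin k} → IsColoring G d → Shared d → IsMergedColoring (d ∘ redirect)
  redirect-merged {d = d} (proper , onto) (u , u≢v , du≡dv) =
    (proper ∘ redirect-edge , onto′) , cong d (trans redirect-v (sym (redirect-≢ (v≢w ∘ sym))))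
    where
    onto′ : StrictlySurjective _≡_ (d ∘ redirect)
    onto′ x with onto x
    ... | u₀ , du₀≡x with u₀ ≟ v
    ...   | yes refl = u , trans (cong d (redirect-≢ u≢v)) (trans du≡dv du₀≡x)
    ...   | no  u₀≢v = u₀ , trans (cong d (redirect-≢ u₀≢v)) du₀≡x

  module _ {k} {d e : Fin n → Fin k} (coloring : IsColoring G d) {u} (u≢v : u ≢ v) (du≡dv : d u ≡ d v)
           (d∘redirect≋e : (d ∘ redirect) ≋ e) where

    d-via-redirect : ∀ {i j} → i ≢ v → j ≢ v → (d i == d j) ≡ (e i == e j)
    d-via-redirect {i} {j} i≢v j≢v =
      trans (cong₂ _==_ (cong d (sym (redirect-≢ i≢v))) (cong d (sym (redirect-≢ j≢v)))) (classes d∘redirect≋e i j)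

    free-recolour : ¬ Used e (e u)
    free-recolour (u′ , vu′∈G , eu′≡eu) = proj₁ coloring vu′∈G (sym (trans du′≡du du≡dv))
      where
      du′≡du : d u′ ≡ d u
      du′≡du = Equivalence.to T-==
        (subst T (sym (d-via-redirect (edge⇒≢ G vu′∈G ∘ sym) u≢v)) (Equivalence.from T-== eu′≡eu))

    recolor-redirect : d ≋ recolor e (e u)
    recolor-redirect = ≋-off v
      (λ {i} {j} i≢v j≢v → trans (d-via-redirect i≢v j≢v) (sym (recolor-off-v e (e u) i≢v j≢v)))
      (λ {j} j≢v → trans (cong (_== d j) (sym du≡dv))
                    (trans (d-via-redirect u≢v j≢v)
                           (sym (cong₂ _==_ (recolor-v e (e u)) (recolor-≢ e (e u) j≢v)))))

  recolorings : ∀ {k} → (Fin n → Fin k) → List (Fin n → Fin k)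
  recolorings e = map (recolor e) (freeColours e)

  shared-transversal : ∀ k → IsTransversal (partitionSetoid n k)
    ((_∈≋ colorings G k) ∩ Shared) (concatMap recolorings (mergedClasses k))
  shared-transversal k = record
    { unique   = UniqueSetoidₚ.concat⁺ setoid
                   (Allₚ.map⁺ (All.map recolorings-unique allMerged))
                   (allPairs-map⁺-on recolorings-disjoint allMerged
                      (IsTransversal.unique (deduplicate-isTransversal (partitionDecSetoid n k) (merged k))))
    ; sound    = Allₚ.concat⁺ (Allₚ.map⁺ (All.map recolorings-sound allMerged))
    ; complete = complete′
    }
    where
    open Equivalence
    setoid = partitionSetoid n k
    open SetoidMembership setoid using () renaming (_∈_ to _∈ₛ_)

    allMerged : All IsMergedColoring (mergedClasses k)
    allMerged = All.tabulate ∈-mergedClasses⁻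

    free : ∀ {e : Fin n → Fin k} {x} → x ∈ freeColours e → ¬ Used e x
    free {e} x∈ = proj₂ (∈-filter⁻ (∁? (used? e)) {xs = allFin k} x∈)

    recolorings-unique : ∀ {e} → IsMergedColoring e → UniqueSetoid.Unique setoid (recolorings e)
    recolorings-unique {e} merged-e = AllPairsₚ.map⁺ (AllPairs.map
      (λ {x} {x′} x≢x′ r≈r′ → x≢x′ (recolor-injective merged-e (≈⇒≋ {c = recolor e x} {recolor e x′} r≈r′)))
      (Uniqueₚ.filter⁺ (∁? (used? e)) (Uniqueₚ.allFin⁺ k)))

    ∈ₛ-recolorings⁻ : ∀ {c e} → c ∈ₛ recolorings e → ∃ λ x → c ≋ recolor e x
    ∈ₛ-recolorings⁻ {c} {e} c∈ with find c∈
    ... | r , r∈ , c≈r with ∈-map⁻ (recolor e) r∈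
    ...   | x , _ , refl = x , ≈⇒≋ {c = c} {recolor e x} c≈r

    recolorings-disjoint : ∀ {e e′} → IsMergedColoring e → IsMergedColoring e′ → ¬ T (equivColoring e e′) →
      Disjoint setoid (recolorings e) (recolorings e′)
    recolorings-disjoint {e} {e′} merged-e merged-e′ e≉e′ {c} (c∈ , c∈′) =
      let x , c≋r = ∈ₛ-recolorings⁻ {c} {e} c∈
          x′ , c≋r′ = ∈ₛ-recolorings⁻ {c} {e′} c∈′
      in e≉e′ (≋⇒≈ (recolor-reflects-≋ merged-e merged-e′ (≋-trans (≋-sym c≋r) c≋r′)))

    recolorings-sound : ∀ {e} → IsMergedColoring e → All ((_∈≋ colorings G k) ∩ Shared) (recolorings e)
    recolorings-sound {e} merged-e = Allₚ.map⁺ (All.tabulate λ {x} x∈ →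
      ∈≋-colorings⁺ G (recolor-isColoring merged-e (free {e} x∈)) , recolor-Shared merged-e)

    through : ∀ {c d} → d ∈ colorings G k → c ≋ d → Shared d → c ∈≋ concatMap recolorings (mergedClasses k)
    through {c} {d} d∈ c≋d shared-d@(u , u≢v , du≡dv) =
      let e , e∈ , d∘redirect≋e = mergedClasses-complete (redirect-merged (∈-colorings⁻ G d∈) shared-d)
          coloring = ∈-colorings⁻ G d∈
          eu-free = ∈-filter⁺ (∁? (used? e)) (∈-allFin (e u)) (free-recolour coloring u≢v du≡dv d∘redirect≋e)
      in lose (∈-concatMap⁺ recolorings (lose e∈ (∈-map⁺ (recolor e) eu-free)))
              (≋⇒≈ {c = c} {recolor e (e u)} (≋-trans c≋d (recolor-redirect coloring u≢v du≡dv d∘redirect≋e)))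

    complete′ : ∀ {c} → c ∈≋ colorings G k × Shared c → c ∈≋ concatMap recolorings (mergedClasses k)
    complete′ {c} (c∈ , shared-c) with find c∈
    ... | d , d∈ , c≈d = through {c} {d} d∈ (≈⇒≋ {c = c} {d} c≈d) (Shared-resp {c = c} {d} c≈d shared-c)

  adjacent? : Decidable (λ u → adj G v u ≡ true)
  adjacent? u = adj G v u Bool.≟ true

  neighbours : List (Fin n)
  neighbours = filter adjacent? (allFin n)

  degree : ℕ
  degree = length neighbours

  usedColours-length : ∀ {k} {e : Fin n → Fin k} → IsMergedColoring e → length (usedColours e) ≡ degree
  usedColours-length {k} {e} ((proper , _) , _) =
    trans (transversal-length (≡.setoid (Fin k)) usedColours-transversal usedOnNeighbours) (length-map e neighbours)
    where
    adjacent : All (λ u → adj G v u ≡ true) neighbours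
    adjacent = Allₚ.all-filter adjacent? (allFin n)
    ≢v : ∀ {u} → adj G v u ≡ true → u ≢ v
    ≢v vu∈G = edge⇒≢ G vu∈G ∘ sym
    usedColours-transversal : IsTransversal (≡.setoid (Fin k)) (Used e) (usedColours e)
    usedColours-transversal = record
      { unique   = Uniqueₚ.filter⁺ (used? e) (Uniqueₚ.allFin⁺ k)
      ; sound    = Allₚ.all-filter (used? e) (allFin k)
      ; complete = ∈-filter⁺ (used? e) (∈-allFin _)
      }
    -- The neighbours of v form a clique of G - vw, so e colours them injectively.
    usedOnNeighbours : IsTransversal (≡.setoid (Fin k)) (Used e) (map e neighbours)
    usedOnNeighbours = record
      { unique   = allPairs-map⁺-on
                     (λ {u} {u′} vu∈G vu′∈G u≢u′ →
                        proper (G⊆G′-off-v (simplicial u u′ vu∈G vu′∈G u≢u′) (≢v vu∈G) (≢v vu′∈G)))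
                     adjacent (Uniqueₚ.filter⁺ adjacent? (Uniqueₚ.allFin⁺ n))
      ; sound    = Allₚ.map⁺ (All.map (λ {u} vu∈G → u , vu∈G , refl) adjacent)
      ; complete = λ (u , vu∈G , eu≡x) →
                     subst (_∈ map e neighbours) eu≡x (∈-map⁺ e (∈-filter⁺ adjacent? (∈-allFin u) vu∈G))
      }

  freeColours-length : ∀ {k} {e : Fin n → Fin k} → IsMergedColoring e → length (freeColours e) ≡ k ∸ degree
  freeColours-length {k} {e} merged-e =
    trans (sym (m+n∸m≡n degree (length (freeColours e)))) (cong (_∸ degree) used+free≡k)
    where
    open ≡-Reasoning
    used+free≡k : degree + length (freeColours e) ≡ k
    used+free≡k = begin
      degree + length (freeColours e)               ≡⟨ cong (_+ length (freeColours e)) (usedColours-length merged-e) ⟨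
      length (usedColours e) + length (freeColours e) ≡⟨ length-filter+length-filter-∁ (used? e) (allFin k) ⟩
      length (allFin k)                             ≡⟨ length-tabulate id ⟩
      k                                             ∎

  S-simplicial : ∀ k → S G (suc k) ≡ mergedCount k + mergedCount (suc k) * (suc k ∸ degree)
  S-simplicial k = begin
    S G (suc k)                                                 ≡⟨ S≡length {G = G} split ⟩
    length (concatMap recolorings (mergedClasses (suc k)) ++ map isolate (mergedClasses k))
                                                                ≡⟨ length-++ (concatMap recolorings (mergedClasses (suc k))) ⟩
    length (concatMap recolorings (mergedClasses (suc k))) + length (map isolate (mergedClasses k))
                                                                ≡⟨ cong₂ _+_ recolored (length-map isolate (mergedClasses k)) ⟩
    mergedCount (suc k) * (suc k ∸ degree) + mergedCount k      ≡⟨ +-comm _ (mergedCount k) ⟩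
    mergedCount k + mergedCount (suc k) * (suc k ∸ degree)      ∎
    where
    open ≡-Reasoning
    split : IsTransversal (partitionSetoid n (suc k)) (_∈≋ colorings G (suc k))
              (concatMap recolorings (mergedClasses (suc k)) ++ map isolate (mergedClasses k))
    split = transversal-++ (partitionSetoid n (suc k)) {Q = Shared} (λ {c} {d} → Shared-resp {c = c} {d}) shared?
              (shared-transversal (suc k)) (isolated-transversal k)
    recolored : length (concatMap recolorings (mergedClasses (suc k))) ≡ mergedCount (suc k) * (suc k ∸ degree)
    recolored = length-concatMap-const (All.map recolorings-length (All.tabulate ∈-mergedClasses⁻))
      where
      recolorings-length : ∀ {e} → IsMergedColoring e → length (recolorings e) ≡ suc k ∸ degree
      recolorings-length {e} merged-e = trans (length-map (recolor e) (freeColours e)) (freeColours-length merged-e)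

  mergedCount≡0 : ∀ {k} → (∀ {e : Fin n → Fin k} → ¬ IsMergedColoring e) → mergedCount k ≡ 0
  mergedCount≡0 {k} none with mergedClasses k in eq
  ... | []    = refl
  ... | e ∷ _ = contradiction (∈-mergedClasses⁻ (subst (e ∈_) (sym eq) (here refl))) none

  mergedCount-zero : mergedCount 0 ≡ 0
  mergedCount-zero = mergedCount≡0 λ {e} _ → ¬Fin0 (e v)

  mergedCount-n : mergedCount n ≡ 0
  mergedCount-n = mergedCount≡0 λ ((_ , onto) , ev≡ew) → <-irrefl refl (merging-surjective⇒< v≢w ev≡ew onto)

fraction-< : ∀ {t b t′ b′} → t′ * suc b < t * suc b′ → (ℤ.+ t′) / suc b′ ℚ.< (ℤ.+ t) / suc b
fraction-< {t} {b} {t′} {b′} t′b<tb′ = toℚᵘ-cancel-<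
  (<-respˡ-≃ (≃-sym (toℚᵘ-fromℚᵘ (mkℚᵘ (ℤ.+ t′) b′))) (<-respʳ-≃ (≃-sym (toℚᵘ-fromℚᵘ (mkℚᵘ (ℤ.+ t) b)))
    (*<* (subst₂ ℤ._<_ (pos-* t′ (suc b)) (pos-* t (suc b′)) (+<+ t′b<tb′)))))

𝓐-< : ∀ {n n′} (H : Graph n) (H′ : Graph n′) → 0 < 𝓑 H → 0 < 𝓑 H′ →
  𝓣 H′ * 𝓑 H < 𝓣 H * 𝓑 H′ → 𝓐 H′ ℚ.< 𝓐 H
𝓐-< H H′ 0<B 0<B′ lt with 𝓑 H | 𝓑 H′
... | suc b | suc b′ = fraction-< {𝓣 H} {b} {𝓣 H′} {b′} lt

theorem7 : ∀ {n : ℕ} (G : Graph n) (v w : Fin n) →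
    Simplicial G v → adj G v w ≡ true →
    𝓐 G > 𝓐 (removeEdge G v w)
theorem7 {zero}  G () w
theorem7 {suc m} G v w simplicial vw∈G =
  𝓐-< G G′ (𝓑-positive G) (𝓑-positive G′)
    (averageInequality (suc m) degree mergedCount (λ i → S G (suc i)) mergedCount-zero mergedCount-n S-simplicial
       (λ i → S G′ (suc i)) (S-removeEdge ∘ suc) 0<∑mergedCount)
  where
  open SimplicialEdgeRemoval G simplicial vw∈G
  𝓑-positive : (H : Graph (suc m)) → 0 < 𝓑 H
  𝓑-positive H = ≤-trans (S-positive H) (term≤∑ (suc m) (λ i → S H (suc i)) (n<1+n m))
  0<∑mergedCount : 0 < ∑ (suc m) mergedCount
  0<∑mergedCount = ≤-trans (subst (0 <_) S≡mergedCount (S-positive G)) (term≤∑ (suc m) mergedCount (n<1+n m))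
    where
    S≡mergedCount : S G (suc m) ≡ mergedCount m
    S≡mergedCount = trans (S-simplicial m) (trans (cong (λ x → mergedCount m + x * (suc m ∸ degree)) mergedCount-n)
                                                  (+-identityʳ (mergedCount m)))
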